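{- Let $\alpha$ be an infinite word over $\{2,3\}$. For all $n\in\mathbb{N}$, the graph $W^\alpha_n$ is isomorphic to an induced subgraph of $\mathcal{P}^\alpha$.
   Context: For an infinite word $\alpha=\alpha_1\alpha_2\cdots$ over $\{0,1,2,3\}$, the infinite graph $\mathcal{P}^\alpha$ has vertex set $\{v_{i,j}: i,j\in\mathbb{N}\}$ ($i$ is the row, $j$ the column). The only edges are between consecutive columns $j$ and $j+1$, determined by $\alpha_j$: if $\alpha_j=0$, $v_{i,j}v_{k,j+1}$ is an edge iff $i=k$; if $\alpha_j=1$, iff $i\neq k$; if $\alpha_j=2$, iff $i\le k$; if $\alpha_j=3$, iff $i\ge k$. For $\alpha$ over $\{2,3\}$ and $n\in\mathbb{N}$, the graph $W^\alpha_n$ has vertices $u_{i,j}$, $1\le i,j\le n$; vertex $u_{i,j}$ lies on diagonal $D_{i+j-1}$. There is an edge between $u_{i,j}$ and $u_{k,l}$ exactly when, for some $m$, $u_{i,j}\in D_m$, $u_{k,l}\in D_{m+1}$, and either $\alpha_m=2$ and $k\ge i$, or $\alpha_m=3$ and $l\ge j$. -}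

module Defs where

open import Data.Nat using (ℕ; suc; _+_; _≤_; _≥_)
open import Data.Fin using (Fin; toℕ)
open import Data.Product using (_×_; _,_; Σ)
open import Data.Sum using (_⊎_)
open import Relation.Binary.PropositionalEquality using (_≡_; _≢_)
open import Function.Bundles using (_⇔_)
open import Function.Definitions using (Injective)

data Letter : Set where
  l0 l1 l2 l3 : Letter

-- Infinite words, indexed from 0: (α 0) is the paper's α₁.
Word : Set
Word = ℕ → Letter

Over23 : Word → Set
Over23 α = ∀ j → α j ≡ l2 ⊎ α j ≡ l3

-- Edge rule between consecutive columns for a letter a
-- (i = row in column j, k = row in column j+1).
LetterEdge : Letter → ℕ → ℕ → Set
LetterEdge l0 i k = i ≡ k
LetterEdge l1 i k = i ≢ k
LetterEdge l2 i k = i ≤ k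
LetterEdge l3 i k = i ≥ k

-- Vertices of P^α: v_{i,j} encoded as (i , j) (row , column), 0-indexed.
PVertex : Set
PVertex = ℕ × ℕ

PEdge→ : Word → PVertex → PVertex → Set
PEdge→ α (i , j) (k , l) = (l ≡ suc j) × LetterEdge (α j) i k

PAdj : Word → PVertex → PVertex → Set
PAdj α x y = PEdge→ α x y ⊎ PEdge→ α y x

-- Vertices of W^α_n: u_{i,j} with 1 ≤ i,j ≤ n, encoded 0-indexed as Fin n × Fin n.
-- u_{i,j} lies on diagonal D_{i+j-1}, which in 0-indexed coordinates is i + j
-- (and the paper's letter α_m corresponds to α (m - 1)).
WVertex : ℕ → Set
WVertex n = Fin n × Fin n

diag : ∀ {n} → WVertex n → ℕ
diag (i , j) = toℕ i + toℕ j

WEdge→ : Word → ∀ {n} → WVertex n → WVertex n → Set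
WEdge→ α {n} (i , j) (k , l) =
  (diag {n} (k , l) ≡ suc (diag {n} (i , j))) ×
  ((α (diag {n} (i , j)) ≡ l2 × toℕ k ≥ toℕ i) ⊎
   (α (diag {n} (i , j)) ≡ l3 × toℕ l ≥ toℕ j))

WAdj : Word → ∀ {n} → WVertex n → WVertex n → Set
WAdj α x y = WEdge→ α x y ⊎ WEdge→ α y x

InducedEmbedding : Word → ℕ → Set
InducedEmbedding α n =
  Σ (WVertex n → PVertex) λ f →
    Injective _≡_ _≡_ f × (∀ x y → WAdj α x y ⇔ PAdj α (f x) (f y))

-- Place u_{i,j} in column d = i + j of P^α, at row i + c(d), where c(d) counts the letters 3
-- among α_d, …, α_{N-1} for a bound N beyond every diagonal. Across a 2-step c stays constant
-- and the row condition is i ≤ k; across a 3-step c drops by one, turning the condition of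
-- P^α into k ≤ i + 1, which on consecutive diagonals is exactly j ≤ l.
module Submission where

open import Defs
open import Data.Nat using (ℕ; zero; suc; _+_; _∸_; _≤_; _<_; s≤s)
open import Data.Nat.Properties
  using (+-suc; +-monoˡ-≤; +-monoʳ-≤; +-cancelˡ-≤; +-cancelʳ-≤; +-cancelˡ-≡; +-mono-<; ≤-trans; ≤-reflexive)
open import Data.Fin using (toℕ)
open import Data.Fin.Properties using (toℕ-injective; toℕ<n)
open import Data.Product using (_×_; _,_)
open import Data.Product.Properties using (,-injective)
open import Data.Sum using (_⊎_; inj₁; inj₂)
open import Data.Sum.Function.Propositional using (_⊎-⇔_)
open import Relation.Binary.PropositionalEquality using (_≡_; refl; sym; trans; cong; cong₂)
open import Function.Bundles using (_⇔_; mk⇔; Equivalence)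
open import Function.Definitions using (Injective)

n<m⇒m∸n≡suc[m∸suc[n]] : ∀ {m n} → n < m → m ∸ n ≡ suc (m ∸ suc n)
n<m⇒m∸n≡suc[m∸suc[n]] {suc m} {zero}  _       = refl
n<m⇒m∸n≡suc[m∸suc[n]] {suc m} {suc n} (s≤s p) = n<m⇒m∸n≡suc[m∸suc[n]] p

module _ {i j k l : ℕ} (e : k + l ≡ suc (i + j)) where

  antidiagonal-≤ : j ≤ l → k ≤ suc i
  antidiagonal-≤ j≤l = +-cancelʳ-≤ j k (suc i) (≤-trans (+-monoʳ-≤ k j≤l) (≤-reflexive e))

  antidiagonal-≥ : k ≤ suc i → j ≤ l
  antidiagonal-≥ k≤1+i = +-cancelˡ-≤ (suc i) j l (≤-trans (≤-reflexive (sym e)) (+-monoˡ-≤ l k≤1+i))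

isThree : Letter → ℕ
isThree l3 = 1
isThree _  = 0

threesFrom : Word → (length start : ℕ) → ℕ
threesFrom α zero    d = 0
threesFrom α (suc f) d = isThree (α d) + threesFrom α f (suc d)

letterEdge⇔ : ∀ {a} → a ≡ l2 ⊎ a ≡ l3 → ∀ {c i j k l} → k + l ≡ suc (i + j) →
              (a ≡ l2 × i ≤ k ⊎ a ≡ l3 × j ≤ l) ⇔ LetterEdge a (isThree a + c + i) (c + k)
letterEdge⇔ (inj₁ refl) {c} {i} {j} {k} {l} e = mk⇔ to from
  where
  to : l2 ≡ l2 × i ≤ k ⊎ l2 ≡ l3 × j ≤ l → c + i ≤ c + k
  to (inj₁ (_ , i≤k)) = +-monoʳ-≤ c i≤k
  to (inj₂ (() , _))
  from : c + i ≤ c + k → l2 ≡ l2 × i ≤ k ⊎ l2 ≡ l3 × j ≤ l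
  from p = inj₁ (refl , +-cancelˡ-≤ c i k p)
letterEdge⇔ (inj₂ refl) {c} {i} {j} {k} {l} e = mk⇔ to from
  where
  to : l3 ≡ l2 × i ≤ k ⊎ l3 ≡ l3 × j ≤ l → c + k ≤ suc (c + i)
  to (inj₁ (() , _))
  to (inj₂ (_ , j≤l)) = ≤-trans (+-monoʳ-≤ c (antidiagonal-≤ e j≤l)) (≤-reflexive (+-suc c i))
  from : c + k ≤ suc (c + i) → l3 ≡ l2 × i ≤ k ⊎ l3 ≡ l3 × j ≤ l
  from p = inj₂ (refl , antidiagonal-≥ e (+-cancelˡ-≤ c k (suc i) (≤-trans p (≤-reflexive (sym (+-suc c i))))))

module _ (α : Word) (over23 : Over23 α) (n : ℕ) where

  bound : ℕ
  bound = n + n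

  diag<bound : (x : WVertex n) → diag x < bound
  diag<bound (i , j) = +-mono-< (toℕ<n i) (toℕ<n j)

  level : ℕ → ℕ
  level d = threesFrom α (bound ∸ d) d

  level-step : ∀ {d} → d < bound → level d ≡ isThree (α d) + level (suc d)
  level-step d<bound rewrite n<m⇒m∸n≡suc[m∸suc[n]] d<bound = refl

  place : WVertex n → PVertex
  place x@(i , _) = level (diag x) + toℕ i , diag x

  place-injective : Injective _≡_ _≡_ place
  place-injective {i , j} {k , l} eq with ,-injective eq
  ... | rows , diags = cong₂ _,_ (toℕ-injective i≡k) (toℕ-injective j≡l)
    where
    i≡k : toℕ i ≡ toℕ k
    i≡k = +-cancelˡ-≡ (level (toℕ k + toℕ l)) _ _ (trans (cong (λ d → level d + toℕ i) (sym diags)) rows)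
    j≡l : toℕ j ≡ toℕ l
    j≡l = +-cancelˡ-≡ (toℕ k) _ _ (trans (cong (_+ toℕ j) (sym i≡k)) diags)

  wEdge→⇔pEdge→ : ∀ x y → WEdge→ α x y ⇔ PEdge→ α (place x) (place y)
  wEdge→⇔pEdge→ x@(i , j) y@(k , l) =
    mk⇔ (λ (e , p) → e , Equivalence.to (rows e) p) (λ (e , q) → e , Equivalence.from (rows e) q)
    where
    rows : diag y ≡ suc (diag x) →
           (α (diag x) ≡ l2 × toℕ i ≤ toℕ k ⊎ α (diag x) ≡ l3 × toℕ j ≤ toℕ l)
             ⇔ LetterEdge (α (diag x)) (level (diag x) + toℕ i) (level (diag y) + toℕ k)
    rows e rewrite e | level-step (diag<bound x) = letterEdge⇔ (over23 (diag x)) e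

  embedding : InducedEmbedding α n
  embedding = place , place-injective , λ x y → wEdge→⇔pEdge→ x y ⊎-⇔ wEdge→⇔pEdge→ y x

lemma3p2 : (α : Word) → Over23 α → (n : ℕ) → InducedEmbedding α n
lemma3p2 = embedding
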